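{- Let $\sigma=(\sqrt5-1)/2$. Consider a board given by a set $B$ of cells and a set $J$ of allowed jumps, where each jump is an ordered triple $(p,q,r)$ of distinct cells of $B$ (a man at $p$ jumps over a man at $q$ into the empty cell $r$, and the man at $q$ is removed), and $J$ is closed under reversal: $(p,q,r)\in J$ implies $(r,q,p)\in J$. Let $e:B\to\mathbb{Z}$ be an integer exponent function such that the weighting $w(c)=\sigma^{e(c)}$ is a pagoda function, i.e. $\sigma^{e(p)}+\sigma^{e(q)}\ge\sigma^{e(r)}$ for every $(p,q,r)\in J$. The loss of a jump $(p,q,r)$ is $\sigma^{e(p)}+\sigma^{e(q)}-\sigma^{e(r)}\ \ (\ge 0)$. Suppose that no jump $(p,q,r)\in J$ has $(e(p),e(q),e(r))=(a,a,a-1)$ for some integer $a$. Consider a configuration of men on $B$ (each cell holding at most one man) with finitely many men, and let $E$ be the maximum of $e(c)$ over occupied cells $c$. Then: (1) every jump that can legally be executed from this configuration either has loss $0$ or has loss at least $\sigma^{E}$; (2) if any finite sequence of legal jumps, each of loss $0$, is performed starting from this configuration, then the maximum exponent $e(c)$ over occupied cells of the resulting configuration is at most $E$.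
   Context: A jump $(p,q,r)$ can legally be executed from a configuration if $p$ and $q$ are occupied and $r$ is empty; afterwards $p$ and $q$ are empty and $r$ is occupied. The total weight of a configuration is the sum of $\sigma^{e(c)}$ over occupied cells $c$; the loss of a jump is the decrease of the total weight it causes. -}

module Defs where

open import Data.Integer using (ℤ; +_; -[1+_]; _+_; _-_; _*_; -_; _≤_)
open import Data.Nat using (ℕ; zero; suc)
open import Data.Bool using (Bool; true; false)
open import Data.Product using (_×_; Σ; ∃)
open import Data.Sum using (_⊎_)
open import Data.List using (List)
open import Data.List.Membership.Propositional using (_∈_)
open import Relation.Binary.PropositionalEquality using (_≡_; _≢_)
open import Relation.Nullary using (¬_)

-- The ring ℤ[σ], σ = (√5 - 1)/2, σ² = 1 - σ.  An element  a + b·σ.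
-- Every power σ^e (e ∈ ℤ) lies in ℤ[σ]  (σ⁻¹ = 1 + σ), and 1, σ are
-- linearly independent over ℚ, so equality is componentwise.

record Zσ : Set where
  constructor _+_σ
  field
    re : ℤ
    im : ℤ
open Zσ public

infixl 6 _⊕_ _⊖_
_⊕_ : Zσ → Zσ → Zσ
(a + b σ) ⊕ (c + d σ) = (a + c) + (b + d) σ

_⊖_ : Zσ → Zσ → Zσ
(a + b σ) ⊖ (c + d σ) = (a - c) + (b - d) σ

𝟘 : Zσ
𝟘 = (+ 0) + (+ 0) σ

𝟙 : Zσ
𝟙 = (+ 1) + (+ 0) σ

-- multiplication by σ :  (a + bσ)σ = b + (a - b)σ
mulσ : Zσ → Zσ
mulσ (a + b σ) = b + (a - b) σ

-- multiplication by σ⁻¹ = 1 + σ :  (a + bσ)(1 + σ) = (a + b) + aσ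
mulφ : Zσ → Zσ
mulφ (a + b σ) = (a + b) + a σ

σ^ℕ : ℕ → Zσ
σ^ℕ zero    = 𝟙
σ^ℕ (suc n) = mulσ (σ^ℕ n)

φ^ℕ : ℕ → Zσ
φ^ℕ zero    = 𝟙
φ^ℕ (suc n) = mulφ (φ^ℕ n)

σ^ : ℤ → Zσ
σ^ (+ n)      = σ^ℕ n
σ^ -[1+ n ]   = φ^ℕ (suc n)

-- Order: x + y√5 ≥ 0 for integers x, y (exact real-number order).
NonnegSqrt5 : ℤ → ℤ → Set
NonnegSqrt5 x y =
  ((+ 0 ≤ x) × (+ 0 ≤ y))
  ⊎ ((+ 0 ≤ x) × ((+ 5) * (y * y) ≤ x * x))
  ⊎ ((+ 0 ≤ y) × (x * x ≤ (+ 5) * (y * y)))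

-- a + bσ = ((2a - b) + b√5)/2, so a + bσ ≥ 0  iff  (2a - b) + b√5 ≥ 0.
Nonneg : Zσ → Set
Nonneg (a + b σ) = NonnegSqrt5 ((+ 2) * a - b) b

_≤σ_ : Zσ → Zσ → Set
x ≤σ y = Nonneg (y ⊖ x)

module Board {Cell : Set} (J : Cell → Cell → Cell → Set) (e : Cell → ℤ) where

  loss : Cell → Cell → Cell → Zσ
  loss p q r = (σ^ (e p) ⊕ σ^ (e q)) ⊖ σ^ (e r)

  Config : Set
  Config = Cell → Bool

  FiniteConfig : Config → Set
  FiniteConfig C = Σ (List Cell) λ xs → ∀ c → C c ≡ true → c ∈ xs

  IsMaxExp : Config → ℤ → Set
  IsMaxExp C E = (∃ λ c → C c ≡ true × e c ≡ E) × (∀ c → C c ≡ true → e c ≤ E)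

  Legal : Config → Cell → Cell → Cell → Set
  Legal C p q r = J p q r × C p ≡ true × C q ≡ true × C r ≡ false

  Step : Config → Cell → Cell → Cell → Config → Set
  Step C p q r C' =
    Legal C p q r × C' p ≡ false × C' q ≡ false × C' r ≡ true
    × (∀ x → x ≢ p → x ≢ q → x ≢ r → C' x ≡ C x)

  data ZeroSteps : Config → Config → Set where
    done : ∀ {C} → ZeroSteps C C
    step : ∀ {C C' C''} p q r → Step C p q r C' → loss p q r ≡ 𝟘
           → ZeroSteps C' C'' → ZeroSteps C C''

{-# OPTIONS --safe #-}
module Submission where

-- Multiplication by φ = σ⁻¹ preserves the order of ℤ[σ], so a jump may be rescaled by φⁿ
-- with n above all exponents involved.  Then σ^(n-k) becomes φ^k = F(k+1) + F(k)σ, F the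
-- Fibonacci numbers, and a jump from exponents n-i, n-j to n-k has loss φ^i + φ^j - φ^k.
-- If k ≤ i, this exceeds φ^m coefficientwise for every m ≤ j, which gives (1) with n-m = E.
-- If k > i, j, then up to symmetry either (i, j, k) = (i, i, i+1), which is excluded, or
-- (j+1, j, j+2), of loss 0 as φ^(j+2) = φ^(j+1) + φ^j; every other such triple has
-- φ^k ≥ φ^i + φ^j coefficientwise and strictly somewhere, violating the pagoda condition.
-- For (2), a zero-loss jump has σ^c = σ^a + σ^b > σ^a, so it lands on a cell of exponent
-- c < a ≤ E.

open import Defs
open import Data.Bool using (true; false)
open import Data.Empty using (⊥-elim)
open import Data.Integer
  using (ℤ; +_; -[1+_]; _+_; _-_; _*_; -_; _≤_; _<_; _≤?_; ∣_∣; _⊔_; +≤+; -≤+;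
         nonNegative; positive)
open import Data.Integer.Properties
open import Data.Integer.Tactic.RingSolver using (solve-∀)
open import Data.Nat.Base as ℕ using (ℕ; zero; suc; z≤n; s≤s)
import Data.Nat.Properties as ℕ
open import Algebra.Properties.CommutativeSemigroup ℕ.+-commutativeSemigroup using (interchange)
open import Data.Product as Product using (_×_; _,_; ∃; ∃-syntax)
open import Data.Sum as Sum using (_⊎_; inj₁; inj₂)
open import Relation.Binary.PropositionalEquality
open import Relation.Nullary using (¬_; yes; no)
open import Relation.Nullary.Decidable using (decidable-stable)

private variable
  a b i j k l x y u v : ℤ
  A B C D : ℕ

i+d≡j⇒i≤j : ∀ d → + 0 ≤ d → i + d ≡ j → i ≤ j
i+d≡j⇒i≤j {i} d 0≤d refl = i≤i+j i d {{nonNegative 0≤d}}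

*-nonNeg : + 0 ≤ i → + 0 ≤ j → + 0 ≤ i * j
*-nonNeg {i} {j} 0≤i 0≤j =
  subst (_≤ i * j) (*-zeroʳ i) (*-monoˡ-≤-nonNeg i {{nonNegative 0≤i}} 0≤j)

square-nonNeg : ∀ i → + 0 ≤ i * i
square-nonNeg (+ n)    = *-nonNeg {+ n} {+ n} (+≤+ z≤n) (+≤+ z≤n)
square-nonNeg -[1+ n ] = +≤+ z≤n

*-mono-≤-nonNeg : + 0 ≤ i → + 0 ≤ k → i ≤ j → k ≤ l → i * k ≤ j * l
*-mono-≤-nonNeg {i} {k} {j} {l} 0≤i 0≤k i≤j k≤l = ≤-trans
  (*-monoʳ-≤-nonNeg k {{nonNegative 0≤k}} i≤j)
  (*-monoˡ-≤-nonNeg j {{nonNegative (≤-trans 0≤i i≤j)}} k≤l)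

square-mono-< : + 0 ≤ i → i < j → i * i < j * j
square-mono-< {i} {j} 0≤i i<j = ≤-<-trans
  (*-monoˡ-≤-nonNeg i {{nonNegative 0≤i}} (<⇒≤ i<j))
  (*-monoʳ-<-pos j {{positive (≤-<-trans 0≤i i<j)}} i<j)

j*j≤i*i⇒0≤i+j : + 0 ≤ i → j * j ≤ i * i → + 0 ≤ i + j
j*j≤i*i⇒0≤i+j {i} {j} 0≤i jj≤ii with + 0 ≤? i + j
... | yes 0≤i+j = 0≤i+j
... | no  0≰i+j = ⊥-elim (<⇒≱ (subst (i * i <_) (neg-square j) (square-mono-< 0≤i i<-j)) jj≤ii)
  where
    neg-square : ∀ j → - j * - j ≡ j * j
    neg-square = solve-∀
    i<-j : i < - j
    i<-j = subst₂ _<_ (+-identityʳ i) (lemma i j) (+-monoʳ-< i (neg-mono-< (≰⇒> 0≰i+j)))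
      where lemma : ∀ i j → i + - (i + j) ≡ - j
            lemma = solve-∀

RationalPartDominates IrrationalPartDominates : ℤ → ℤ → Set
RationalPartDominates   x y = + 0 ≤ x × + 5 * (y * y) ≤ x * x
IrrationalPartDominates x y = + 0 ≤ y × x * x ≤ + 5 * (y * y)

NonnegSqrt5-cases : NonnegSqrt5 x y → RationalPartDominates x y ⊎ IrrationalPartDominates x y
NonnegSqrt5-cases {x} {y} (inj₁ (0≤x , 0≤y)) with ≤-total (+ 5 * (y * y)) (x * x)
... | inj₁ 5yy≤xx = inj₁ (0≤x , 5yy≤xx)
... | inj₂ xx≤5yy = inj₂ (0≤y , xx≤5yy)
NonnegSqrt5-cases (inj₂ dominates) = dominates

norm-* : ∀ x y u v →
  (x * u + + 5 * (y * v)) * (x * u + + 5 * (y * v)) - + 5 * ((x * v + y * u) * (x * v + y * u))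
    ≡ (x * x - + 5 * (y * y)) * (u * u - + 5 * (v * v))
norm-* = solve-∀

-- The next three lemmas are the sign cases of (x + y√5)(u + v√5) = (xu + 5yv) + (xv + yu)√5:
-- the dominating part is found from the multiplicative norm x² - 5y² (norm-*).
RationalPartDominates-* : RationalPartDominates x y → RationalPartDominates u v →
                          RationalPartDominates (x * u + + 5 * (y * v)) (x * v + y * u)
RationalPartDominates-* {x} {y} {u} {v} (0≤x , 5yy≤xx) (0≤u , 5vv≤uu) = 0≤X , 5YY≤XX
  where
    5-squares-nonNeg : ∀ y → + 0 ≤ + 5 * (y * y)
    5-squares-nonNeg y = *-nonNeg {+ 5} (+≤+ z≤n) (square-nonNeg y)
    lhs : ∀ y v → + 5 * (y * y) * (+ 5 * (v * v)) ≡ + 5 * (y * v) * (+ 5 * (y * v))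
    lhs = solve-∀
    rhs : ∀ x u → x * x * (u * u) ≡ x * u * (x * u)
    rhs = solve-∀
    0≤X : + 0 ≤ x * u + + 5 * (y * v)
    0≤X = j*j≤i*i⇒0≤i+j (*-nonNeg {x} {u} 0≤x 0≤u) (subst₂ _≤_ (lhs y v) (rhs x u)
      (*-mono-≤-nonNeg (5-squares-nonNeg y) (5-squares-nonNeg v) 5yy≤xx 5vv≤uu))
    5YY≤XX : + 5 * ((x * v + y * u) * (x * v + y * u)) ≤ (x * u + + 5 * (y * v)) * (x * u + + 5 * (y * v))
    5YY≤XX = 0≤i-j⇒j≤i (subst (+ 0 ≤_) (sym (norm-* x y u v))
      (*-nonNeg (i≤j⇒0≤j-i 5yy≤xx) (i≤j⇒0≤j-i 5vv≤uu)))

IrrationalPartDominates-* : IrrationalPartDominates x y → IrrationalPartDominates u v →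
                            RationalPartDominates (x * u + + 5 * (y * v)) (x * v + y * u)
IrrationalPartDominates-* {x} {y} {u} {v} (0≤y , xx≤5yy) (0≤v , uu≤5vv) = 0≤X , 5YY≤XX
  where
    lhs : ∀ x u → x * x * (u * u) ≡ x * u * (x * u)
    lhs = solve-∀
    rhs : ∀ y v → + 5 * (y * y) * (+ 5 * (v * v)) ≡ + 5 * (y * v) * (+ 5 * (y * v))
    rhs = solve-∀
    flip : ∀ a b c d → (b - a) * (d - c) ≡ (a - b) * (c - d)
    flip = solve-∀
    0≤X : + 0 ≤ x * u + + 5 * (y * v)
    0≤X = subst (+ 0 ≤_) (+-comm (+ 5 * (y * v)) (x * u)) (j*j≤i*i⇒0≤i+j
      (*-nonNeg {+ 5} (+≤+ z≤n) (*-nonNeg {y} {v} 0≤y 0≤v)) (subst₂ _≤_ (lhs x u) (rhs y v)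
        (*-mono-≤-nonNeg (square-nonNeg x) (square-nonNeg u) xx≤5yy uu≤5vv)))
    5YY≤XX : + 5 * ((x * v + y * u) * (x * v + y * u)) ≤ (x * u + + 5 * (y * v)) * (x * u + + 5 * (y * v))
    5YY≤XX = 0≤i-j⇒j≤i (subst (+ 0 ≤_) (trans (flip (x * x) (+ 5 * (y * y)) (u * u) (+ 5 * (v * v)))
      (sym (norm-* x y u v))) (*-nonNeg (i≤j⇒0≤j-i xx≤5yy) (i≤j⇒0≤j-i uu≤5vv)))

PartDominates-*-mixed : RationalPartDominates x y → IrrationalPartDominates u v →
                        IrrationalPartDominates (x * u + + 5 * (y * v)) (x * v + y * u)
PartDominates-*-mixed {x} {y} {u} {v} (0≤x , 5yy≤xx) (0≤v , uu≤5vv) = 0≤Y , XX≤5YY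
  where
    lhs : ∀ y u → y * y * (u * u) ≡ (y * u) * (y * u)
    lhs = solve-∀
    mid : ∀ y v → + 5 * (y * y) * (v * v) ≡ y * y * (+ 5 * (v * v))
    mid = solve-∀
    rhs : ∀ x v → x * x * (v * v) ≡ (x * v) * (x * v)
    rhs = solve-∀
    yu≤xv : (y * u) * (y * u) ≤ (x * v) * (x * v)
    yu≤xv = subst₂ _≤_ (lhs y u) (rhs x v) (≤-trans
      (*-monoˡ-≤-nonNeg (y * y) {{nonNegative (square-nonNeg y)}} uu≤5vv)
      (subst (_≤ x * x * (v * v)) (mid y v)
        (*-monoʳ-≤-nonNeg (v * v) {{nonNegative (square-nonNeg v)}} 5yy≤xx)))
    0≤Y : + 0 ≤ x * v + y * u
    0≤Y = j*j≤i*i⇒0≤i+j (*-nonNeg {x} {v} 0≤x 0≤v) yu≤xv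
    XX≤5YY : (x * u + + 5 * (y * v)) * (x * u + + 5 * (y * v)) ≤ + 5 * ((x * v + y * u) * (x * v + y * u))
    XX≤5YY = i-j≤0⇒i≤j (subst (_≤ + 0) (sym (norm-* x y u v))
      (subst (_≤ + 0) (*-comm (u * u - + 5 * (v * v)) (x * x - + 5 * (y * y)))
        (*-monoʳ-≤-nonNeg (x * x - + 5 * (y * y)) {{nonNegative (i≤j⇒0≤j-i 5yy≤xx)}}
          (i≤j⇒i-j≤0 uu≤5vv))))

NonnegSqrt5-* : NonnegSqrt5 x y → NonnegSqrt5 u v →
                NonnegSqrt5 (x * u + + 5 * (y * v)) (x * v + y * u)
NonnegSqrt5-* {x} {y} {u} {v} p q with NonnegSqrt5-cases p | NonnegSqrt5-cases q
... | inj₁ r | inj₁ s = inj₂ (inj₁ (RationalPartDominates-* {x} {y} {u} {v} r s))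
... | inj₂ r | inj₂ s = inj₂ (inj₁ (IrrationalPartDominates-* {x} {y} {u} {v} r s))
... | inj₁ r | inj₂ s = inj₂ (inj₂ (PartDominates-*-mixed {x} {y} {u} {v} r s))
... | inj₂ r | inj₁ s = subst₂ NonnegSqrt5 (swapX x y u v) (swapY x y u v)
  (inj₂ (inj₂ (PartDominates-*-mixed {u} {v} {x} {y} s r)))
  where
    swapX : ∀ x y u v → u * x + + 5 * (v * y) ≡ x * u + + 5 * (y * v)
    swapX = solve-∀
    swapY : ∀ x y u v → u * y + v * x ≡ x * v + y * u
    swapY = solve-∀

NonnegSqrt5-halve : NonnegSqrt5 (+ 2 * x) (+ 2 * y) → NonnegSqrt5 x y
NonnegSqrt5-halve {x} {y} p = inj₂ (Sum.map
  (Product.map halve (λ 5yy≤xx → quarter (subst₂ _≤_ (five-squares y) (squares x) 5yy≤xx)))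
  (Product.map halve (λ xx≤5yy → quarter (subst₂ _≤_ (squares x) (five-squares y) xx≤5yy)))
  (NonnegSqrt5-cases p))
  where
    halve : + 0 ≤ + 2 * i → + 0 ≤ i
    halve {i} = *-cancelˡ-≤-pos (+ 0) i (+ 2)
    quarter : + 4 * i ≤ + 4 * j → i ≤ j
    quarter {i} {j} = *-cancelˡ-≤-pos i j (+ 4)
    squares : ∀ x → (+ 2 * x) * (+ 2 * x) ≡ + 4 * (x * x)
    squares = solve-∀
    five-squares : ∀ y → + 5 * ((+ 2 * y) * (+ 2 * y)) ≡ + 4 * (+ 5 * (y * y))
    five-squares = solve-∀

-- In the coordinates of Nonneg, 2φ = 1 + √5 and 2σ = -1 + √5.
Nonneg-mulφ : ∀ z → Nonneg z → Nonneg (mulφ z)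
Nonneg-mulφ (a + b σ) p =
  NonnegSqrt5-halve (subst₂ NonnegSqrt5 (re-eq a b) (im-eq a b) (NonnegSqrt5-* p 2φ-nonneg))
  where
    2φ-nonneg : NonnegSqrt5 (+ 1) (+ 1)
    2φ-nonneg = inj₁ (+≤+ z≤n , +≤+ z≤n)
    re-eq : ∀ a b → (+ 2 * a - b) * + 1 + + 5 * (b * + 1) ≡ + 2 * (+ 2 * (a + b) - a)
    re-eq = solve-∀
    im-eq : ∀ a b → (+ 2 * a - b) * + 1 + b * + 1 ≡ + 2 * a
    im-eq = solve-∀

Nonneg-mulσ : ∀ z → Nonneg z → Nonneg (mulσ z)
Nonneg-mulσ (a + b σ) p =
  NonnegSqrt5-halve (subst₂ NonnegSqrt5 (re-eq a b) (im-eq a b) (NonnegSqrt5-* p 2σ-nonneg))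
  where
    2σ-nonneg : NonnegSqrt5 (- + 1) (+ 1)
    2σ-nonneg = inj₂ (inj₂ (+≤+ z≤n , +≤+ (s≤s z≤n)))
    re-eq : ∀ a b → (+ 2 * a - b) * - + 1 + + 5 * (b * + 1) ≡ + 2 * (+ 2 * b - (a - b))
    re-eq = solve-∀
    im-eq : ∀ a b → (+ 2 * a - b) * + 1 + b * - + 1 ≡ + 2 * (a - b)
    im-eq = solve-∀

Nonneg-quadrant : + 0 ≤ a → + 0 ≤ b → Nonneg (a + b σ)
Nonneg-quadrant {a} {b} 0≤a 0≤b with + 0 ≤? + 2 * a - b
... | yes 0≤x = inj₁ (0≤x , 0≤b)
... | no  0≰x = inj₂ (inj₂ (0≤b , ≤-trans xx≤bb bb≤5bb))
  where
    0≤-x : + 0 ≤ - (+ 2 * a - b)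
    0≤-x = neg-mono-≤ (<⇒≤ (≰⇒> 0≰x))
    -x≤b : - (+ 2 * a - b) ≤ b
    -x≤b = i+d≡j⇒i≤j (+ 2 * a) (*-nonNeg {+ 2} (+≤+ z≤n) 0≤a) (lemma a b)
      where lemma : ∀ a b → - (+ 2 * a - b) + + 2 * a ≡ b
            lemma = solve-∀
    xx≤bb : (+ 2 * a - b) * (+ 2 * a - b) ≤ b * b
    xx≤bb = subst (_≤ b * b) (neg-square (+ 2 * a - b)) (*-mono-≤-nonNeg 0≤-x 0≤-x -x≤b -x≤b)
      where neg-square : ∀ x → - x * - x ≡ x * x
            neg-square = solve-∀
    bb≤5bb : b * b ≤ + 5 * (b * b)
    bb≤5bb = i+d≡j⇒i≤j (+ 4 * (b * b)) (*-nonNeg {+ 4} (+≤+ z≤n) (square-nonNeg b)) (lemma b)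
      where lemma : ∀ b → b * b + + 4 * (b * b) ≡ + 5 * (b * b)
            lemma = solve-∀

-- Over ℝ: a ≤ 0 ≤ a + bσ forces b ≥ 0, hence a + b ≥ a + bσ ≥ 0.
Nonneg⇒0≤re+im : a ≤ + 0 → Nonneg (a + b σ) → + 0 ≤ a + b
Nonneg⇒0≤re+im {a} {b} a≤0 p with NonnegSqrt5-cases p
... | inj₁ (0≤x , 5bb≤xx) = subst (+ 0 ≤_) (lemma a b) (+-mono-≤ 0≤x+2b (neg-mono-≤ a≤0))
  where
    lemma : ∀ a b → (+ 2 * a - b) + + 2 * b + - a ≡ a + b
    lemma = solve-∀
    4bb≤5bb : (+ 2 * b) * (+ 2 * b) ≤ + 5 * (b * b)
    4bb≤5bb = i+d≡j⇒i≤j (b * b) (square-nonNeg b) (eq b)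
      where eq : ∀ b → (+ 2 * b) * (+ 2 * b) + b * b ≡ + 5 * (b * b)
            eq = solve-∀
    0≤x+2b : + 0 ≤ (+ 2 * a - b) + + 2 * b
    0≤x+2b = j*j≤i*i⇒0≤i+j 0≤x (≤-trans 4bb≤5bb 5bb≤xx)
... | inj₂ (0≤b , xx≤5bb) =
  *-cancelˡ-≤-pos (+ 0) (a + b) (+ 2)
    (subst (+ 0 ≤_) (lemma a b) (j*j≤i*i⇒0≤i+j 0≤3b (≤-trans xx≤5bb 5bb≤9bb)))
  where
    lemma : ∀ a b → + 3 * b + (+ 2 * a - b) ≡ + 2 * (a + b)
    lemma = solve-∀
    0≤3b : + 0 ≤ + 3 * b
    0≤3b = *-nonNeg {+ 3} (+≤+ z≤n) 0≤b
    5bb≤9bb : + 5 * (b * b) ≤ (+ 3 * b) * (+ 3 * b)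
    5bb≤9bb = i+d≡j⇒i≤j (+ 4 * (b * b)) (*-nonNeg {+ 4} (+≤+ z≤n) (square-nonNeg b)) (eq b)
      where eq : ∀ b → + 5 * (b * b) + + 4 * (b * b) ≡ (+ 3 * b) * (+ 3 * b)
            eq = solve-∀

coefficientwise-≤σ : C ℕ.≤ A → D ℕ.≤ B → ((+ C) + (+ D) σ) ≤σ ((+ A) + (+ B) σ)
coefficientwise-≤σ C≤A D≤B = Nonneg-quadrant (i≤j⇒0≤j-i (+≤+ C≤A)) (i≤j⇒0≤j-i (+≤+ D≤B))

coefficient-sum-≰σ : A ℕ.≤ C → A ℕ.+ B ℕ.< C ℕ.+ D → ¬ (((+ C) + (+ D) σ) ≤σ ((+ A) + (+ B) σ))
coefficient-sum-≰σ {A} {C} {B} {D} A≤C A+B<C+D p = ℕ.<⇒≱ A+B<C+D (drop‿+≤+ (0≤i-j⇒j≤i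
  (subst (+ 0 ≤_) (lemma (+ A) (+ B) (+ C) (+ D)) (Nonneg⇒0≤re+im (i≤j⇒i-j≤0 (+≤+ A≤C)) p))))
  where lemma : ∀ a b c d → a - c + (b - d) ≡ a + b - (c + d)
        lemma = solve-∀

re-<⇒⊖≢𝟘 : C ℕ.< A → ((+ A) + (+ B) σ) ⊖ ((+ C) + (+ D) σ) ≢ 𝟘
re-<⇒⊖≢𝟘 {C} {A} C<A eq = ℕ.<-irrefl (sym (+-injective (i-j≡0⇒i≡j (+ A) (+ C) (cong re eq)))) C<A

⊕-comm : ∀ z w → z ⊕ w ≡ w ⊕ z
⊕-comm (a + b σ) (c + d σ) = cong₂ _+_σ (+-comm a c) (+-comm b d)

⊖-⊖ : ∀ z w t → z ⊖ w ⊖ t ≡ z ⊖ (w ⊕ t)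
⊖-⊖ (a + b σ) (c + d σ) (e + f σ) = cong₂ _+_σ (lemma a c e) (lemma b d f)
  where lemma : ∀ a c e → a - c - e ≡ a - (c + e)
        lemma = solve-∀

⊖-self : ∀ z → z ⊖ z ≡ 𝟘
⊖-self (a + b σ) = cong₂ _+_σ (+-inverseʳ a) (+-inverseʳ b)

mulφ-⊕ : ∀ z w → mulφ (z ⊕ w) ≡ mulφ z ⊕ mulφ w
mulφ-⊕ (a + b σ) (c + d σ) = cong (_+ (a + c) σ) (lemma a b c d)
  where lemma : ∀ a b c d → a + c + (b + d) ≡ a + b + (c + d)
        lemma = solve-∀

mulφ-⊖ : ∀ z w → mulφ (z ⊖ w) ≡ mulφ z ⊖ mulφ w
mulφ-⊖ (a + b σ) (c + d σ) = cong (_+ (a - c) σ) (lemma a b c d)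
  where lemma : ∀ a b c d → a - c + (b - d) ≡ a + b - (c + d)
        lemma = solve-∀

mulσ-mulφ : ∀ z → mulσ (mulφ z) ≡ z
mulσ-mulφ (a + b σ) = cong (a +_σ) (lemma a b)
  where lemma : ∀ a b → a + b - a ≡ b
        lemma = solve-∀

mulφ-mulσ : ∀ z → mulφ (mulσ z) ≡ z
mulφ-mulσ (a + b σ) = cong (_+ b σ) (lemma a b)
  where lemma : ∀ a b → b + (a - b) ≡ a
        lemma = solve-∀

mulφ-σ^ : ∀ i → mulφ (σ^ i) ≡ σ^ (i - + 1)
mulφ-σ^ (+ zero)    = refl
mulφ-σ^ (+ suc n)   = mulφ-mulσ (σ^ℕ n)
mulφ-σ^ -[1+ n ]    = cong (λ m → φ^ℕ (suc (suc m))) (sym (ℕ.+-identityʳ n))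

scaleφ : ℕ → Zσ → Zσ
scaleφ zero    z = z
scaleφ (suc n) z = scaleφ n (mulφ z)

scaleφ-⊕ : ∀ n z w → scaleφ n (z ⊕ w) ≡ scaleφ n z ⊕ scaleφ n w
scaleφ-⊕ zero    z w = refl
scaleφ-⊕ (suc n) z w = trans (cong (scaleφ n) (mulφ-⊕ z w)) (scaleφ-⊕ n (mulφ z) (mulφ w))

scaleφ-⊖ : ∀ n z w → scaleφ n (z ⊖ w) ≡ scaleφ n z ⊖ scaleφ n w
scaleφ-⊖ zero    z w = refl
scaleφ-⊖ (suc n) z w = trans (cong (scaleφ n) (mulφ-⊖ z w)) (scaleφ-⊖ n (mulφ z) (mulφ w))

scaleφ-𝟘 : ∀ n → scaleφ n 𝟘 ≡ 𝟘
scaleφ-𝟘 zero    = refl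
scaleφ-𝟘 (suc n) = scaleφ-𝟘 n

scaleφ-injective : ∀ n {z w} → scaleφ n z ≡ scaleφ n w → z ≡ w
scaleφ-injective zero    eq = eq
scaleφ-injective (suc n) {z} {w} eq = begin
  z                 ≡⟨ mulσ-mulφ z ⟨
  mulσ (mulφ z)     ≡⟨ cong mulσ (scaleφ-injective n eq) ⟩
  mulσ (mulφ w)     ≡⟨ mulσ-mulφ w ⟩
  w                 ∎
  where open ≡-Reasoning

scaleφ-Nonneg : ∀ n z → Nonneg z → Nonneg (scaleφ n z)
scaleφ-Nonneg zero    z p = p
scaleφ-Nonneg (suc n) z p = scaleφ-Nonneg n (mulφ z) (Nonneg-mulφ z p)

scaleφ-Nonneg⁻¹ : ∀ n z → Nonneg (scaleφ n z) → Nonneg z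
scaleφ-Nonneg⁻¹ zero    z p = p
scaleφ-Nonneg⁻¹ (suc n) z p =
  subst Nonneg (mulσ-mulφ z) (Nonneg-mulσ (mulφ z) (scaleφ-Nonneg⁻¹ n (mulφ z) p))

scaleφ-σ^ : ∀ n k → scaleφ n (σ^ (+ n - + k)) ≡ φ^ℕ k
scaleφ-σ^ zero    zero    = refl
scaleφ-σ^ zero    (suc k) = refl
scaleφ-σ^ (suc n) k = begin
  scaleφ n (mulφ (σ^ (+ suc n - + k)))   ≡⟨ cong (scaleφ n) (mulφ-σ^ (+ suc n - + k)) ⟩
  scaleφ n (σ^ (+ suc n - + k - + 1))    ≡⟨ cong (λ i → scaleφ n (σ^ i)) (lemma (+ n) (+ k)) ⟩
  scaleφ n (σ^ (+ n - + k))              ≡⟨ scaleφ-σ^ n k ⟩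
  φ^ℕ k                                  ∎
  where
    open ≡-Reasoning
    lemma : ∀ n k → + 1 + n - k - + 1 ≡ n - k
    lemma = solve-∀

weightLoss : ℤ → ℤ → ℤ → Zσ
weightLoss a b c = σ^ a ⊕ σ^ b ⊖ σ^ c

φLoss : ℕ → ℕ → ℕ → Zσ
φLoss i j k = φ^ℕ i ⊕ φ^ℕ j ⊖ φ^ℕ k

scaleφ-weightLoss : ∀ n i j k → scaleφ n (weightLoss (+ n - + i) (+ n - + j) (+ n - + k)) ≡ φLoss i j k
scaleφ-weightLoss n i j k = begin
  scaleφ n (σ^ (+ n - + i) ⊕ σ^ (+ n - + j) ⊖ σ^ (+ n - + k))
    ≡⟨ scaleφ-⊖ n _ _ ⟩
  scaleφ n (σ^ (+ n - + i) ⊕ σ^ (+ n - + j)) ⊖ scaleφ n (σ^ (+ n - + k))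
    ≡⟨ cong₂ _⊖_ (scaleφ-⊕ n _ _) (scaleφ-σ^ n k) ⟩
  scaleφ n (σ^ (+ n - + i)) ⊕ scaleφ n (σ^ (+ n - + j)) ⊖ φ^ℕ k
    ≡⟨ cong (λ t → t ⊖ φ^ℕ k) (cong₂ _⊕_ (scaleφ-σ^ n i) (scaleφ-σ^ n j)) ⟩
  φLoss i j k ∎
  where open ≡-Reasoning

fib : ℕ → ℕ
fib zero          = 0
fib (suc zero)    = 1
fib (suc (suc n)) = fib (suc n) ℕ.+ fib n

fib-pos : ∀ n → 0 ℕ.< fib (suc n)
fib-pos zero    = s≤s z≤n
fib-pos (suc n) = ℕ.≤-trans (fib-pos n) (ℕ.m≤m+n (fib (suc n)) (fib n))

fib-mono : ∀ {m n} → m ℕ.≤ n → fib m ℕ.≤ fib n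
fib-mono z≤n                   = z≤n
fib-mono {n = suc n} (s≤s z≤n) = fib-pos n
fib-mono (s≤s (s≤s m≤n))       = ℕ.+-mono-≤ (fib-mono (s≤s m≤n)) (fib-mono m≤n)

fib-< : ∀ {m n} → m ℕ.< n → fib (suc (suc m)) ℕ.< fib (suc (suc n))
fib-< {m} {suc n} (s≤s m≤n) =
  ℕ.≤-<-trans (fib-mono (s≤s (s≤s m≤n))) (ℕ.m<m+n (fib (suc (suc n))) (fib-pos n))

φ^ℕ-fib : ∀ k → φ^ℕ k ≡ (+ fib (suc k)) + (+ fib k) σ
φ^ℕ-fib zero    = refl
φ^ℕ-fib (suc k) = cong mulφ (φ^ℕ-fib k)

φ^ℕ-⊕-fib : ∀ i j → φ^ℕ i ⊕ φ^ℕ j ≡ (+ (fib (suc i) ℕ.+ fib (suc j))) + (+ (fib i ℕ.+ fib j)) σ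
φ^ℕ-⊕-fib i j = cong₂ _⊕_ (φ^ℕ-fib i) (φ^ℕ-fib j)

φLoss-golden : ∀ j → φLoss (suc j) j (suc (suc j)) ≡ 𝟘
φLoss-golden j = ⊖-self (φ^ℕ (suc j) ⊕ φ^ℕ j)

φ^ℕ≤σφLoss : ∀ {i j k m} → k ℕ.≤ i → m ℕ.≤ j → φ^ℕ m ≤σ φLoss i j k
φ^ℕ≤σφLoss {i} {j} {k} {m} k≤i m≤j =
  subst Nonneg (sym (⊖-⊖ (φ^ℕ i ⊕ φ^ℕ j) (φ^ℕ k) (φ^ℕ m)))
    (subst₂ _≤σ_ (sym (φ^ℕ-⊕-fib k m)) (sym (φ^ℕ-⊕-fib i j))
      (coefficientwise-≤σ (ℕ.+-mono-≤ (fib-mono (s≤s k≤i)) (fib-mono (s≤s m≤j)))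
                          (ℕ.+-mono-≤ (fib-mono k≤i) (fib-mono m≤j))))

φLoss-negative : ∀ {i j l} → i ℕ.≤ suc l → j ℕ.≤ l → i ℕ.≤ l ⊎ j ℕ.< l →
                 ¬ Nonneg (φLoss i j (suc (suc l)))
φLoss-negative {i} {j} {l} i≤1+l j≤l strict p =
  coefficient-sum-≰σ source≤target sum<sum (subst₂ _≤σ_ (φ^ℕ-fib (suc (suc l))) (φ^ℕ-⊕-fib i j) p)
  where
    source≤target : fib (suc i) ℕ.+ fib (suc j) ℕ.≤ fib (suc (suc (suc l)))
    source≤target = ℕ.+-mono-≤ (fib-mono (s≤s i≤1+l)) (fib-mono (s≤s j≤l))
    shifted< : i ℕ.≤ l ⊎ j ℕ.< l →
               fib (suc (suc i)) ℕ.+ fib (suc (suc j)) ℕ.< fib (suc (suc (suc (suc l))))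
    shifted< (inj₁ i≤l) = ℕ.+-mono-<-≤ (fib-< (s≤s i≤l)) (fib-mono (s≤s (s≤s j≤l)))
    shifted< (inj₂ j<l) = ℕ.+-mono-≤-< (fib-mono (s≤s (s≤s i≤1+l))) (fib-< j<l)
    sum<sum : (fib (suc i) ℕ.+ fib (suc j)) ℕ.+ (fib i ℕ.+ fib j)
              ℕ.< fib (suc (suc (suc l))) ℕ.+ fib (suc (suc l))
    sum<sum = subst (ℕ._< fib (suc (suc (suc (suc l)))))
      (interchange (fib (suc i)) (fib i) (fib (suc j)) (fib j)) (shifted< strict)

heavy-target⇒φLoss≡𝟘 : ∀ {i j k} → j ℕ.≤ i → i ℕ.< k → ¬ (i ≡ j × k ≡ suc i) →
  Nonneg (φLoss i j k) → φLoss i j k ≡ 𝟘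
heavy-target⇒φLoss≡𝟘 {i} {j} {suc k} j≤i (s≤s i≤k) excluded p with ℕ.m≤n⇒m<n∨m≡n i≤k
... | inj₁ (s≤s i≤l) =
  ⊥-elim (φLoss-negative (ℕ.m≤n⇒m≤1+n i≤l) (ℕ.≤-trans j≤i i≤l) (inj₁ i≤l) p)
... | inj₂ refl with ℕ.m≤n⇒m<n∨m≡n j≤i
...   | inj₂ refl = ⊥-elim (excluded (refl , refl))
...   | inj₁ (s≤s j≤l) with ℕ.m≤n⇒m<n∨m≡n j≤l
...     | inj₂ refl = φLoss-golden j
...     | inj₁ j<l  = ⊥-elim (φLoss-negative ℕ.≤-refl (ℕ.<⇒≤ j<l) (inj₂ j<l) p)

φLoss-dichotomy-ordered : ∀ {i j k m} → j ℕ.≤ i → m ℕ.≤ j → ¬ (i ≡ j × k ≡ suc i) →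
  Nonneg (φLoss i j k) → φLoss i j k ≡ 𝟘 ⊎ φ^ℕ m ≤σ φLoss i j k
φLoss-dichotomy-ordered {i} {j} {k} j≤i m≤j excluded p with k ℕ.≤? i
... | yes k≤i = inj₂ (φ^ℕ≤σφLoss k≤i m≤j)
... | no  k≰i = inj₁ (heavy-target⇒φLoss≡𝟘 j≤i (ℕ.≰⇒> k≰i) excluded p)

φLoss-dichotomy : ∀ {i j k m} → m ℕ.≤ i → m ℕ.≤ j → ¬ (i ≡ j × k ≡ suc i) →
  Nonneg (φLoss i j k) → φLoss i j k ≡ 𝟘 ⊎ φ^ℕ m ≤σ φLoss i j k
φLoss-dichotomy {i} {j} {k} {m} m≤i m≤j excluded p with ℕ.≤-total j i
... | inj₁ j≤i = φLoss-dichotomy-ordered j≤i m≤j excluded p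
... | inj₂ i≤j = subst (λ L → L ≡ 𝟘 ⊎ φ^ℕ m ≤σ L) (sym swap)
  (φLoss-dichotomy-ordered i≤j m≤i (λ { (refl , k≡1+j) → excluded (refl , k≡1+j) })
    (subst Nonneg swap p))
  where
    swap : φLoss i j k ≡ φLoss j i k
    swap = cong (_⊖ φ^ℕ k) (⊕-comm (φ^ℕ i) (φ^ℕ j))

φLoss-≢𝟘 : ∀ {i j k} → k ℕ.≤ i → φLoss i j k ≢ 𝟘
φLoss-≢𝟘 {i} {j} {k} k≤i eq = re-<⇒⊖≢𝟘 {B = fib i ℕ.+ fib j} {D = fib k} target<sources
  (trans (sym (cong₂ _⊖_ (φ^ℕ-⊕-fib i j) (φ^ℕ-fib k))) eq)
  where
    target<sources : fib (suc k) ℕ.< fib (suc i) ℕ.+ fib (suc j)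
    target<sources = ℕ.≤-<-trans (fib-mono (s≤s k≤i)) (ℕ.m<m+n (fib (suc i)) (fib-pos j))

i≤+∣i∣ : ∀ i → i ≤ + ∣ i ∣
i≤+∣i∣ (+ n)    = ≤-refl
i≤+∣i∣ -[1+ n ] = -≤+

≤⇒offset : ∀ {n i} → i ≤ + n → ∃[ k ] i ≡ + n - + k
≤⇒offset {n} {i} i≤n = ∣ + n - i ∣ , (begin
  i                  ≡⟨ lemma i (+ n) ⟩
  + n - (+ n - i)    ≡⟨ cong (_-_ (+ n)) (0≤i⇒+∣i∣≡i (i≤j⇒0≤j-i i≤n)) ⟨
  + n - + ∣ + n - i ∣ ∎)
  where
    open ≡-Reasoning
    lemma : ∀ i n → i ≡ n - (n - i)
    lemma = solve-∀

offset-cancel-≤ : ∀ {n k l} → + n - + k ≤ + n - + l → l ℕ.≤ k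
offset-cancel-≤ {n} {k} {l} h =
  drop‿+≤+ (0≤i-j⇒j≤i (subst (+ 0 ≤_) (lemma (+ n) (+ k) (+ l)) (i≤j⇒0≤j-i h)))
  where lemma : ∀ n k l → n - l - (n - k) ≡ k - l
        lemma = solve-∀

offset-suc : ∀ n k → + n - + suc k ≡ + n - + k - + 1
offset-suc n k = lemma (+ n) (+ k)
  where lemma : ∀ n k → n - (+ 1 + k) ≡ n - k - + 1
        lemma = solve-∀

weightLoss-dichotomy-below : ∀ n {a b c E} → c ≤ + n → E ≤ + n → a ≤ E → b ≤ E →
  ¬ (a ≡ b × c ≡ a - + 1) → σ^ c ≤σ (σ^ a ⊕ σ^ b) →
  weightLoss a b c ≡ 𝟘 ⊎ σ^ E ≤σ weightLoss a b c
weightLoss-dichotomy-below n c≤n E≤n a≤E b≤E excluded p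
  with ≤⇒offset c≤n | ≤⇒offset E≤n | ≤⇒offset (≤-trans a≤E E≤n) | ≤⇒offset (≤-trans b≤E E≤n)
... | kc , refl | kE , refl | ka , refl | kb , refl =
  Sum.map unscale-𝟘 unscale-≤σ
    (φLoss-dichotomy {ka} {kb} {kc} {kE} (offset-cancel-≤ a≤E) (offset-cancel-≤ b≤E) excluded′
      (subst Nonneg scaled (scaleφ-Nonneg n L p)))
  where
    L : Zσ
    L = weightLoss (+ n - + ka) (+ n - + kb) (+ n - + kc)
    scaled : scaleφ n L ≡ φLoss ka kb kc
    scaled = scaleφ-weightLoss n ka kb kc
    excluded′ : ¬ (ka ≡ kb × kc ≡ suc ka)
    excluded′ (refl , refl) = excluded (refl , offset-suc n ka)
    unscale-𝟘 : φLoss ka kb kc ≡ 𝟘 → L ≡ 𝟘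
    unscale-𝟘 eq = scaleφ-injective n (trans scaled (trans eq (sym (scaleφ-𝟘 n))))
    unscale-≤σ : φ^ℕ kE ≤σ φLoss ka kb kc → σ^ (+ n - + kE) ≤σ L
    unscale-≤σ q = scaleφ-Nonneg⁻¹ n (L ⊖ σ^ (+ n - + kE))
      (subst Nonneg (sym (trans (scaleφ-⊖ n L _) (cong₂ _⊖_ scaled (scaleφ-σ^ n kE)))) q)

weightLoss-dichotomy : ∀ {a b c E} → a ≤ E → b ≤ E → ¬ (a ≡ b × c ≡ a - + 1) →
  σ^ c ≤σ (σ^ a ⊕ σ^ b) → weightLoss a b c ≡ 𝟘 ⊎ σ^ E ≤σ weightLoss a b c
weightLoss-dichotomy {c = c} {E} = weightLoss-dichotomy-below ∣ E ⊔ c ∣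
  (≤-trans (i≤j⊔i E c) (i≤+∣i∣ (E ⊔ c))) (≤-trans (i≤i⊔j E c) (i≤+∣i∣ (E ⊔ c)))

weightLoss≢𝟘-below : ∀ n {a b c} → b ≤ + n → c ≤ + n → a ≤ c → weightLoss a b c ≢ 𝟘
weightLoss≢𝟘-below n b≤n c≤n a≤c
  with ≤⇒offset b≤n | ≤⇒offset c≤n | ≤⇒offset (≤-trans a≤c c≤n)
... | kb , refl | kc , refl | ka , refl = λ eq → φLoss-≢𝟘 {ka} {kb} {kc} (offset-cancel-≤ a≤c)
  (trans (sym (scaleφ-weightLoss n ka kb kc)) (trans (cong (scaleφ n) eq) (scaleφ-𝟘 n)))

weightLoss≡𝟘⇒c<a : ∀ {a b c} → weightLoss a b c ≡ 𝟘 → c < a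
weightLoss≡𝟘⇒c<a {b = b} {c} eq = ≰⇒> λ a≤c → weightLoss≢𝟘-below ∣ b ⊔ c ∣
  (≤-trans (i≤i⊔j b c) (i≤+∣i∣ (b ⊔ c))) (≤-trans (i≤j⊔i b c) (i≤+∣i∣ (b ⊔ c))) a≤c eq

module _ {Cell : Set} {J : Cell → Cell → Cell → Set} {e : Cell → ℤ} where
  open Board J e

  Bounded : Config → ℤ → Set
  Bounded C E = ∀ c → C c ≡ true → e c ≤ E

  Step-occupied-before : ∀ {C C' p q r x} → Step C p q r C' → C' x ≡ true → x ≢ r → C x ≡ true
  Step-occupied-before {C' = C'} {x = x} (_ , C'p , C'q , _ , unchanged) C'x x≢r =
    trans (sym (unchanged x (vacated C'p) (vacated C'q) x≢r)) C'x
    where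
      vacated : ∀ {y} → C' y ≡ false → x ≢ y
      vacated C'y refl with () ← trans (sym C'x) C'y

  step-bounded : ∀ {C C' p q r E} → Step C p q r C' → loss p q r ≡ 𝟘 → Bounded C E → Bounded C' E
  step-bounded {p = p} {q} {E = E} jump@((_ , Cp , _ , _) , _) zero-loss bounded x C'x =
    decidable-stable (e x ≤? E) λ ex≰E →
      ex≰E (bounded x (Step-occupied-before jump C'x λ { refl →
        ex≰E (<⇒≤ (<-≤-trans (weightLoss≡𝟘⇒c<a {b = e q} zero-loss) (bounded p Cp))) }))

  zeroSteps-bounded : ∀ {C C' E} → ZeroSteps C C' → Bounded C E → Bounded C' E
  zeroSteps-bounded done                              bounded = bounded
  zeroSteps-bounded (step _ _ _ jump zero-loss rest) bounded =
    zeroSteps-bounded rest (step-bounded jump zero-loss bounded)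

proposition1 :
    {Cell : Set} (J : Cell → Cell → Cell → Set) (e : Cell → ℤ) →
    (∀ p q r → J p q r → p ≢ q × q ≢ r × p ≢ r) →
    (∀ p q r → J p q r → J r q p) →
    (∀ p q r → J p q r → σ^ (e r) ≤σ (σ^ (e p) ⊕ σ^ (e q))) →
    (∀ p q r → J p q r → ¬ (∃ λ a → e p ≡ a × e q ≡ a × e r ≡ a - + 1)) →
    (C : Board.Config J e) → Board.FiniteConfig J e C →
    (E : ℤ) → Board.IsMaxExp J e C E →
    ((∀ p q r → Board.Legal J e C p q r →
        Board.loss J e p q r ≡ 𝟘 ⊎ σ^ E ≤σ Board.loss J e p q r)
     × (∀ C' → Board.ZeroSteps J e C C' →
        ∀ c → C' c ≡ true → e c ≤ E))
proposition1 J e _ _ pagoda no-aaa C _ E (_ , bounded) =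
  (λ p q r (j , Cp , Cq , _) → weightLoss-dichotomy (bounded p Cp) (bounded q Cq)
    (λ (e-p≡e-q , e-r≡) → no-aaa p q r j (e p , refl , sym e-p≡e-q , e-r≡)) (pagoda p q r j)) ,
  (λ C' steps → zeroSteps-bounded steps bounded)
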